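{- Let $p$ be a prime, $\tilde G=\mathrm{GL}_2(\mathbb{F}_{p^2})$, $0\le r,s\le p-1$ and $q,t\ge0$ integers. The map $$\Psi:V^{q,t}_{r,s}(\overline{\mathbb{F}}_p)\to\mathrm{U}^{q+pt}_{r+ps}(\overline{\mathbb{F}}_p),\qquad f\otimes g\mapsto\big((a,b)\mapsto f(a,b)\,g(a^p,b^p)\big)$$ is an embedding of left $\overline{\mathbb{F}}_p[\tilde G]$-modules.
   Context: $V^{q,t}_{r,s}(\overline{\mathbb{F}}_p)=\overline{\mathbb{F}}_p[X,Y]_r\otimes\overline{\mathbb{F}}_p[X,Y]_s$ (homogeneous polynomials of degrees $r$ and $s$), i.e. $\mathrm{Sym}^r\otimes\det^q\otimes(\mathrm{Sym}^s)^\tau\otimes(\det^t)^\tau$ with $\tau$ the Frobenius of $\mathbb{F}_{p^2}$, where $M=\left(\begin{smallmatrix}a&b\\c&d\end{smallmatrix}\right)$ acts by $M\cdot(f\otimes g)=(ad-bc)^{q+pt}f(aX+bY,cX+dY)\otimes g(a^pX+b^pY,c^pX+d^pY)$. $\mathrm{U}^e_d(\overline{\mathbb{F}}_p)$ is the space of functions $F:\mathbb{F}_{p^2}^2\to\overline{\mathbb{F}}_p$ with $F(xa,xb)=x^dF(a,b)$ for $x\in\mathbb{F}_{p^2}^*$ (identified with polynomial functions $F(X,Y)$), with $M\cdot F(X,Y)=\det(M)^eF(aX+bY,cX+dY)$. -}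

module Defs where

open import Level using (Level; _⊔_) renaming (suc to lsuc)
open import Data.Nat using (ℕ; zero; suc; _∸_; _<?_) renaming (_+_ to _+ℕ_; _*_ to _*ℕ_; _^_ to _^ℕ_)
open import Data.Fin using (Fin; toℕ; fromℕ<)
open import Data.Product using (∃)
open import Relation.Nullary using (¬_; yes; no)
open import Algebra.Bundles using (CommutativeRing)
import Algebra.Bundles
import Algebra.Definitions.RawSemiring as RS

-- An algebraic closure of F_p, axiomatised: a field K of characteristic
-- p that is algebraically closed and algebraic over its prime field
-- (every x satisfies x^(p^n) = x for some n ≥ 1).  These properties
-- characterise \overline{F}_p up to isomorphism.

record AlgClosureFp (p : ℕ) (ℓ₁ ℓ₂ : Level) : Set (lsuc (ℓ₁ ⊔ ℓ₂)) where
  field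
    commRing : CommutativeRing ℓ₁ ℓ₂
  open CommutativeRing commRing public
  open RS (Algebra.Bundles.Semiring.rawSemiring semiring) public using (_^_; sum) renaming (_×_ to _·ℕ_)
  field
    1≉0       : ¬ (1# ≈ 0#)
    inverse   : ∀ x → ¬ (x ≈ 0#) → ∃ λ y → (x * y) ≈ 1#
    char-p    : (p ·ℕ 1#) ≈ 0#
    algClosed : ∀ n (a : Fin (suc n) → Carrier) →
                ∃ λ x → ((x ^ suc n) + sum (λ i → a i * (x ^ toℕ i))) ≈ 0#
    algebraic : ∀ x → ∃ λ n → (x ^ (p ^ℕ suc n)) ≈ x

module Setup {p : ℕ} {ℓ₁ ℓ₂ : Level} (K : AlgClosureFp p ℓ₁ ℓ₂) where
  open AlgClosureFp K

  InFp2 : Carrier → Set ℓ₂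
  InFp2 x = (x ^ (p *ℕ p)) ≈ x

  -- Elements of GL_2(F_{p^2}) = (a b ; c d)
  record GL2 : Set (ℓ₁ ⊔ ℓ₂) where
    field
      a b c d : Carrier
      a∈ : InFp2 a
      b∈ : InFp2 b
      c∈ : InFp2 c
      d∈ : InFp2 d
    det : Carrier
    det = (a * d) - (b * c)
    field
      det≉0 : ¬ (det ≈ 0#)

  -- Homogeneous polynomials of degree n in X, Y with coefficients in K:
  -- f i is the coefficient of X^i Y^(n-i).
  HP : ℕ → Set ℓ₁
  HP n = Fin (suc n) → Carrier

  coef : ∀ {n} → HP n → ℕ → Carrier
  coef {n} f k with k <? suc n
  ... | yes k<n = f (fromℕ< k<n)
  ... | no  _   = 0#

  _⊛_ : ∀ {m n} → HP m → HP n → HP (m +ℕ n)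
  (f ⊛ g) i = sum (λ (j : Fin _) → term j (toℕ j <? suc (toℕ i)))
    where
    term : ∀ j → _ → Carrier
    term j (yes _) = f j * coef g (toℕ i ∸ toℕ j)
    term j (no _)  = 0#

  lin : Carrier → Carrier → HP 1
  lin α β Fin.zero = β
  lin α β (Fin.suc Fin.zero) = α

  pow : HP 1 → (k : ℕ) → HP k
  pow L zero    = λ _ → 1#
  pow L (suc k) = L ⊛ pow L k

  symMat : (n : ℕ) → (α β γ δ : Carrier) → Fin (suc n) → Fin (suc n) → Carrier
  symMat n α β γ δ i' i = coef (pow (lin α β) (toℕ i) ⊛ pow (lin γ δ) (n ∸ toℕ i)) (toℕ i')

  -- V^{q,t}_{r,s} = K[X,Y]_r ⊗ K[X,Y]_s, written in the monomial basis
  -- (X^i Y^(r-i)) ⊗ (X^j Y^(s-j)); w i j is the coefficient.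
  V : ℕ → ℕ → Set ℓ₁
  V r s = Fin (suc r) → Fin (suc s) → Carrier

  _≈V_ : ∀ {r s} → V r s → V r s → Set ℓ₂
  w ≈V w' = ∀ i j → w i j ≈ w' i j

  _+V_ : ∀ {r s} → V r s → V r s → V r s
  (w +V w') i j = w i j + w' i j

  _·V_ : ∀ {r s} → Carrier → V r s → V r s
  (λ' ·V w) i j = λ' * w i j

  -- M·(f ⊗ g) = det^(q+pt) f(aX+bY, cX+dY) ⊗ g(a^pX+b^pY, c^pX+d^pY),
  -- extended linearly.
  actV : (r s q t : ℕ) → GL2 → V r s → V r s
  actV r s q t M w i' j' =
    (det ^ (q +ℕ p *ℕ t)) *
    sum (λ i → sum (λ j →
      (w i j * symMat r a b c d i' i) *
      symMat s (a ^ p) (b ^ p) (c ^ p) (d ^ p) j' j))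
    where open GL2 M

  -- Functions are given as K → K → K, only their values on
  -- F_{p^2}^2 matter (equality below is equality on F_{p^2}^2).
  Fun : Set ℓ₁
  Fun = Carrier → Carrier → Carrier

  InU : ℕ → Fun → Set (ℓ₁ ⊔ ℓ₂)
  InU deg F = ∀ x u v → InFp2 x → ¬ (x ≈ 0#) → InFp2 u → InFp2 v →
              F (x * u) (x * v) ≈ ((x ^ deg) * F u v)

  _≈U_ : Fun → Fun → Set (ℓ₁ ⊔ ℓ₂)
  F ≈U G = ∀ u v → InFp2 u → InFp2 v → F u v ≈ G u v

  actU : ℕ → GL2 → Fun → Fun
  actU e M F u v = (det ^ e) * F ((a * u) + (b * v)) ((c * u) + (d * v))
    where open GL2 M

  Ψ : (r s : ℕ) → V r s → Fun
  Ψ r s w u v = sum (λ i → sum (λ j →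
    w i j * (((u ^ toℕ i) * (v ^ (r ∸ toℕ i))) *
             (((u ^ p) ^ toℕ j) * ((v ^ p) ^ (s ∸ toℕ j))))))

  record IsModuleEmbedding (r s q t : ℕ) : Set (ℓ₁ ⊔ ℓ₂) where
    field
      lands-in-U : ∀ w → InU (r +ℕ p *ℕ s) (Ψ r s w)
      additive   : ∀ w w' → Ψ r s (w +V w') ≈U (λ u v → Ψ r s w u v + Ψ r s w' u v)
      homogen    : ∀ λ' w → Ψ r s (λ' ·V w) ≈U (λ u v → λ' * Ψ r s w u v)
      equivariant : ∀ M w → Ψ r s (actV r s q t M w) ≈U actU (q +ℕ p *ℕ t) M (Ψ r s w)
      injective  : ∀ w w' → Ψ r s w ≈U Ψ r s w' → w ≈V w'

{-# OPTIONS --safe #-}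
-- Ψ maps the basis vector X^i Y^(r-i) ⊗ X^j Y^(s-j) to u^i v^(r-i) (u^p)^j (v^p)^(s-j), so
-- linearity and homogeneity of degree r + ps are checked monomial by monomial.  For
-- equivariance, evaluating homogeneous polynomials is multiplicative, so the i-th column of the
-- matrix of M on Sym^r evaluates to (au + bv)^i (cu + dv)^(r-i); on the twisted factor,
-- Frobenius turns a^p u^p + b^p v^p into (au + bv)^p.  For injectivity, r, s < p makes
-- Ψ w (u, 1) a polynomial of degree < p² whose coefficient of u^(i + jp) is w i j (base-p
-- digits); it is determined by its values at the p² distinct points a + bθ of F_{p²}, where
-- θ^p = θ + y₀ and y₀^(p-1) = -1.
module Submission where

open import Defs
open import Level using (Level)
open import Data.Nat using (ℕ; _<_)
open import Data.Nat.Primality using (Prime)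

open import Algebra.Bundles using (CommutativeSemiring; CommutativeRing)
open import Data.Nat using (zero; suc; _≤_; z≤n; s≤s; _!; _<?_)
  renaming (_+_ to _+ℕ_; _*_ to _*ℕ_; _∸_ to _∸ℕ_)
import Data.Nat.Properties as ℕₚ
open ℕₚ using (≤-trans; <-irrefl; n≤1+n; <⇒≤; ∸-monoʳ-<; m+[n∸m]≡n; m≤m+n; _!*_!≢0)
open import Data.Nat.Primality using (euclidsLemma; prime⇒nonTrivial; prime⇒nonZero)
open import Data.Nat.Coprimality using (prime⇒coprime; coprime-Bézout)
open import Data.Nat.GCD using (module Bézout)
open import Data.Nat.Base using (NonZero; nonTrivial⇒n>1; >-nonZero)
open import Data.Nat.Divisibility using (_∣_; divides; ∣⇒≤; m∣m*n; n∣m*n; ∣1⇒≡1)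
open import Data.Nat.DivMod
  using (_%_; _/_; m/n*n≡m; [m+kn]%n≡m%n; m<n⇒m%n≡m; +-distrib-/-∣ʳ; m<n⇒m/n≡0; m*n/n≡m; m%n<n;
         m<n*o⇒m/o<n; m≡m%n+[m/n]*n)
open import Data.Nat.Combinatorics using (_C_; nCk≡n!/k![n-k]!; k![n∸k]!∣n!; nCn≡1)
open import Data.Fin as Fin using (Fin; toℕ; fromℕ<)
open import Data.Fin.Properties using (toℕ<n; fromℕ<-toℕ; fromℕ<-cong; toℕ-fromℕ<)
open import Data.Sum using (inj₁; inj₂)
open import Relation.Nullary using (¬_; yes; no; contradiction)
open import Relation.Binary.Definitions using (tri<; tri≈; tri>)
open import Data.Empty using (⊥-elim)
open import Data.Product using (∃; _,_; proj₁; proj₂)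
open import Function using (_∘_)
import Relation.Binary.PropositionalEquality as ≡
import Algebra.Properties.CommutativeSemigroup as CommutativeSemigroupProperties
open CommutativeSemigroupProperties ℕₚ.+-commutativeSemigroup using ()
  renaming (interchange to +-interchange; x∙yz≈y∙xz to x+[y+z]≡y+[x+z])
open ≡ using (_≡_; cong; subst)

prime∤m! : ∀ {p m} → Prime p → m < p → ¬ p ∣ m !
prime∤m! {p} {zero} pr _ p∣1 =
  <-irrefl (≡.sym (∣1⇒≡1 p∣1)) (nonTrivial⇒n>1 p {{prime⇒nonTrivial pr}})
prime∤m! {p} {suc m} pr m<p p∣m! with euclidsLemma (suc m) (m !) pr p∣m!
... | inj₁ p∣1+m = <-irrefl ≡.refl (≤-trans m<p (∣⇒≤ p∣1+m))
... | inj₂ p∣m!′ = prime∤m! pr (≤-trans (n≤1+n _) m<p) p∣m!′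

nCk*[k!*[n∸k]!]≡n! : ∀ {n k} → k ≤ n → (n C k) *ℕ (k ! *ℕ (n ∸ℕ k) !) ≡ n !
nCk*[k!*[n∸k]!]≡n! {n} {k} k≤n =
  ≡.trans (cong (_*ℕ (k ! *ℕ (n ∸ℕ k) !)) (nCk≡n!/k![n-k]! k≤n))
          (m/n*n≡m {{k !* (n ∸ℕ k) !≢0}} (k![n∸k]!∣n! k≤n))

prime∣pCk : ∀ {p k} → Prime p → 0 < k → k < p → p ∣ p C k
prime∣pCk {p@(suc p-1)} {k} pr 0<k k<p
  with euclidsLemma (p C k) (k ! *ℕ (p ∸ℕ k) !) pr
         (subst (p ∣_) (≡.sym (nCk*[k!*[n∸k]!]≡n! (<⇒≤ k<p))) (m∣m*n (p-1 !)))
... | inj₁ p∣pCk = p∣pCk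
... | inj₂ p∣k!*[p∸k]! with euclidsLemma (k !) ((p ∸ℕ k) !) pr p∣k!*[p∸k]!
...   | inj₁ p∣k!     = contradiction p∣k! (prime∤m! pr k<p)
...   | inj₂ p∣[p∸k]! = contradiction p∣[p∸k]! (prime∤m! pr (∸-monoʳ-< {p} {k} {0} 0<k (<⇒≤ k<p)))

[a+b*n]%n≡a : ∀ {n} .{{_ : NonZero n}} a b → a < n → (a +ℕ b *ℕ n) % n ≡ a
[a+b*n]%n≡a {n} a b a<n = ≡.trans ([m+kn]%n≡m%n a b n) (m<n⇒m%n≡m a<n)

[a+b*n]/n≡b : ∀ {n} .{{_ : NonZero n}} a b → a < n → (a +ℕ b *ℕ n) / n ≡ b
[a+b*n]/n≡b {n} a b a<n =
  ≡.trans (+-distrib-/-∣ʳ a (n∣m*n b)) (≡.cong₂ _+ℕ_ (m<n⇒m/n≡0 a<n) (m*n/n≡m b n))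

module FiniteSums {c ℓ} (R : CommutativeSemiring c ℓ) where

  open CommutativeSemiring R
  import Algebra.Properties.Monoid.Sum +-monoid as MonoidSum
  import Algebra.Properties.CommutativeMonoid.Sum +-commutativeMonoid as CommutativeMonoidSum
  import Algebra.Properties.Semiring.Sum semiring as SemiringSum
  open import Algebra.Solver.Ring.NaturalCoefficients.Default R using (solve; _:=_; _:*_)
  open import Relation.Binary.Reasoning.Setoid setoid

  -- Opaque, so that the summand of a sum can be recovered by unification.
  opaque
    ∑ : ∀ n → (Fin n → Carrier) → Carrier
    ∑ n f = MonoidSum.sum f

  opaque
    unfolding ∑

    sum≡∑ : ∀ n (f : Fin n → Carrier) → MonoidSum.sum f ≡ ∑ n f
    sum≡∑ n f = ≡.refl

    ∑-empty : ∀ (f : Fin 0 → Carrier) → ∑ 0 f ≡ 0#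
    ∑-empty f = ≡.refl

    ∑-suc : ∀ n (f : Fin (suc n) → Carrier) → ∑ (suc n) f ≡ f Fin.zero + ∑ n (λ i → f (Fin.suc i))
    ∑-suc n f = ≡.refl

    ∑-cong : ∀ n {f g : Fin n → Carrier} → (∀ i → f i ≈ g i) → ∑ n f ≈ ∑ n g
    ∑-cong n = MonoidSum.sum-cong-≋

    ∑-zero : ∀ n → ∑ n (λ _ → 0#) ≈ 0#
    ∑-zero = MonoidSum.sum-replicate-zero

    ∑-distrib-+ : ∀ n (f g : Fin n → Carrier) → ∑ n (λ i → f i + g i) ≈ ∑ n f + ∑ n g
    ∑-distrib-+ n = CommutativeMonoidSum.∑-distrib-+

    *-distribˡ-∑ : ∀ n x (f : Fin n → Carrier) → x * ∑ n f ≈ ∑ n (λ i → x * f i)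
    *-distribˡ-∑ n = SemiringSum.*-distribˡ-sum

    *-distribʳ-∑ : ∀ n x (f : Fin n → Carrier) → ∑ n f * x ≈ ∑ n (λ i → f i * x)
    *-distribʳ-∑ n = SemiringSum.*-distribʳ-sum

    ∑-comm : ∀ m n (f : Fin m → Fin n → Carrier) →
             ∑ m (λ i → ∑ n (f i)) ≈ ∑ n (λ j → ∑ m (λ i → f i j))
    ∑-comm m n = CommutativeMonoidSum.∑-comm

  sum²≈∑² : ∀ m n (f : Fin m → Fin n → Carrier) →
            MonoidSum.sum (λ i → MonoidSum.sum (f i)) ≈ ∑ m (λ i → ∑ n (f i))
  sum²≈∑² m n f = trans (reflexive (sum≡∑ m _)) (∑-cong m (λ i → reflexive (sum≡∑ n (f i))))

  opaque
    sumℕ : ℕ → (ℕ → Carrier) → Carrier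
    sumℕ n h = ∑ n (λ i → h (toℕ i))

  opaque
    unfolding sumℕ

    ∑≡sumℕ : ∀ n (h : ℕ → Carrier) → ∑ n (λ i → h (toℕ i)) ≡ sumℕ n h
    ∑≡sumℕ n h = ≡.refl

    sumℕ-empty : ∀ (h : ℕ → Carrier) → sumℕ 0 h ≡ 0#
    sumℕ-empty h = ∑-empty _

    sumℕ-suc : ∀ n (h : ℕ → Carrier) → sumℕ (suc n) h ≡ h 0 + sumℕ n (λ k → h (suc k))
    sumℕ-suc n h = ∑-suc n _

    sumℕ-cong : ∀ n {f g : ℕ → Carrier} → (∀ k → k < n → f k ≈ g k) → sumℕ n f ≈ sumℕ n g
    sumℕ-cong n f≈g = ∑-cong n (λ i → f≈g (toℕ i) (toℕ<n i))

    sumℕ-distrib-+ : ∀ n (f g : ℕ → Carrier) → sumℕ n (λ k → f k + g k) ≈ sumℕ n f + sumℕ n g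
    sumℕ-distrib-+ n f g = ∑-distrib-+ n (λ i → f (toℕ i)) (λ i → g (toℕ i))

    *-distribˡ-sumℕ : ∀ n x (f : ℕ → Carrier) → x * sumℕ n f ≈ sumℕ n (λ k → x * f k)
    *-distribˡ-sumℕ n x f = *-distribˡ-∑ n x (λ i → f (toℕ i))

    *-distribʳ-sumℕ : ∀ n x (f : ℕ → Carrier) → sumℕ n f * x ≈ sumℕ n (λ k → f k * x)
    *-distribʳ-sumℕ n x f = *-distribʳ-∑ n x (λ i → f (toℕ i))

    sumℕ-comm : ∀ m n (f : ℕ → ℕ → Carrier) →
                sumℕ m (λ i → sumℕ n (f i)) ≈ sumℕ n (λ j → sumℕ m (λ i → f i j))
    sumℕ-comm m n f = ∑-comm m n (λ i j → f (toℕ i) (toℕ j))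

  ∑∑≈sumℕ-sumℕ : ∀ m n (g : ℕ → ℕ → Carrier) →
    ∑ m (λ i → ∑ n (λ j → g (toℕ i) (toℕ j))) ≈ sumℕ m (λ a → sumℕ n (g a))
  ∑∑≈sumℕ-sumℕ m n g = trans (∑-cong m (λ i → reflexive (∑≡sumℕ n (g (toℕ i)))))
                              (reflexive (∑≡sumℕ m (λ a → sumℕ n (g a))))

  sumℕ-zero : ∀ n {f : ℕ → Carrier} → (∀ k → k < n → f k ≈ 0#) → sumℕ n f ≈ 0#
  sumℕ-zero n f≈0 = trans (sumℕ-cong n f≈0) (trans (reflexive (≡.sym (∑≡sumℕ n _))) (∑-zero n))

  sumℕ-+ : ∀ m n (h : ℕ → Carrier) → sumℕ (m +ℕ n) h ≈ sumℕ m h + sumℕ n (λ k → h (m +ℕ k))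
  sumℕ-+ zero    n h = trans (sym (+-identityˡ _)) (+-congʳ (reflexive (≡.sym (sumℕ-empty h))))
  sumℕ-+ (suc m) n h = begin
    sumℕ (suc (m +ℕ n)) h                         ≡⟨ sumℕ-suc (m +ℕ n) h ⟩
    h 0 + sumℕ (m +ℕ n) (λ k → h (suc k))         ≈⟨ +-congˡ (sumℕ-+ m n (λ k → h (suc k))) ⟩
    h 0 + (sumℕ m (λ k → h (suc k)) + rest)       ≈⟨ sym (+-assoc _ _ _) ⟩
    (h 0 + sumℕ m (λ k → h (suc k))) + rest       ≡⟨ cong (_+ rest) (≡.sym (sumℕ-suc m h)) ⟩
    sumℕ (suc m) h + rest                         ∎
    where
    rest = sumℕ n (λ k → h (suc m +ℕ k))

  sumℕ-extend : ∀ {m n} (h : ℕ → Carrier) → m ≤ n → (∀ k → m ≤ k → h k ≈ 0#) →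
                sumℕ m h ≈ sumℕ n h
  sumℕ-extend {m} {n} h m≤n h≈0 = begin
    sumℕ m h                                    ≈⟨ sym (+-identityʳ _) ⟩
    sumℕ m h + 0#
      ≈⟨ +-congˡ (sym (sumℕ-zero (n ∸ℕ m) (λ k _ → h≈0 (m +ℕ k) (m≤m+n m k)))) ⟩
    sumℕ m h + sumℕ (n ∸ℕ m) (λ k → h (m +ℕ k))  ≈⟨ sym (sumℕ-+ m (n ∸ℕ m) h) ⟩
    sumℕ (m +ℕ (n ∸ℕ m)) h                      ≡⟨ cong (λ l → sumℕ l h) (m+[n∸m]≡n m≤n) ⟩
    sumℕ n h                                    ∎

  sumℕ-ends : ∀ {n} (h : ℕ → Carrier) → 0 < n → (∀ k → 0 < k → k < n → h k ≈ 0#) →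
              sumℕ (suc n) h ≈ h 0 + h n
  sumℕ-ends {suc n} h _ h≈0 = trans (reflexive (sumℕ-suc (suc n) h)) (+-congˡ (begin
    sumℕ (suc n) (λ k → h (suc k))          ≡⟨ cong (λ l → sumℕ l (λ k → h (suc k))) (ℕₚ.+-comm 1 n) ⟩
    sumℕ (n +ℕ 1) (λ k → h (suc k))         ≈⟨ sumℕ-+ n 1 (λ k → h (suc k)) ⟩
    sumℕ n (λ k → h (suc k)) + sumℕ 1 (λ k → h (suc (n +ℕ k)))
      ≈⟨ +-congˡ (reflexive (≡.trans (sumℕ-suc 0 _) (cong (_ +_) (sumℕ-empty _)))) ⟩
    sumℕ n (λ k → h (suc k)) + (h (suc (n +ℕ 0)) + 0#)
      ≈⟨ +-cong (sumℕ-zero n (λ k k<n → h≈0 (suc k) (s≤s z≤n) (s≤s k<n))) (+-identityʳ _) ⟩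
    0# + h (suc (n +ℕ 0))                   ≈⟨ +-identityˡ _ ⟩
    h (suc (n +ℕ 0))                        ≡⟨ cong (λ l → h (suc l)) (ℕₚ.+-identityʳ n) ⟩
    h (suc n)                               ∎))

  sumℕ-* : ∀ m n (h : ℕ → Carrier) →
           sumℕ (m *ℕ n) h ≈ sumℕ m (λ b → sumℕ n (λ a → h (a +ℕ b *ℕ n)))
  sumℕ-* zero    n h = reflexive (≡.trans (sumℕ-empty h) (≡.sym (sumℕ-empty _)))
  sumℕ-* (suc m) n h = begin
    sumℕ (n +ℕ m *ℕ n) h
      ≈⟨ sumℕ-+ n (m *ℕ n) h ⟩
    sumℕ n h + sumℕ (m *ℕ n) (λ k → h (n +ℕ k))
      ≈⟨ +-cong (sumℕ-cong n (λ a _ → reflexive (cong h (≡.sym (ℕₚ.+-identityʳ a)))))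
                (sumℕ-* m n (λ k → h (n +ℕ k))) ⟩
    sumℕ n (λ a → h (a +ℕ 0)) + sumℕ m (λ b → sumℕ n (λ a → h (n +ℕ (a +ℕ b *ℕ n))))
      ≈⟨ +-congˡ (sumℕ-cong m (λ b _ → sumℕ-cong n (λ a _ →
           reflexive (cong h (x+[y+z]≡y+[x+z] n a (b *ℕ n)))))) ⟩
    sumℕ n (λ a → h (a +ℕ 0 *ℕ n)) + sumℕ m (λ b → sumℕ n (λ a → h (a +ℕ suc b *ℕ n)))
      ≡⟨ ≡.sym (sumℕ-suc m _) ⟩
    sumℕ (suc m) (λ b → sumℕ n (λ a → h (a +ℕ b *ℕ n)))
      ∎

  ∑∑-change-of-basis : ∀ {m n} (w : Fin m → Fin n → Carrier)
    (a : Fin m → Fin m → Carrier) (b : Fin n → Fin n → Carrier) (x : Fin m → Carrier) (y : Fin n → Carrier) →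
    ∑ m (λ i′ → ∑ n (λ j′ → ∑ m (λ i → ∑ n (λ j → (w i j * a i′ i) * b j′ j)) * (x i′ * y j′)))
      ≈ ∑ m (λ i → ∑ n (λ j → w i j * (∑ m (λ i′ → a i′ i * x i′) * ∑ n (λ j′ → b j′ j * y j′))))
  ∑∑-change-of-basis {m} {n} w a b x y = begin
    ∑ m (λ i′ → ∑ n (λ j′ → ∑ m (λ i → ∑ n (λ j → (w i j * a i′ i) * b j′ j)) * (x i′ * y j′)))
      ≈⟨ ∑-cong m (λ i′ → ∑-cong n (λ j′ → trans (*-distribʳ-∑ _ _ _)
           (∑-cong m (λ i → *-distribʳ-∑ _ _ _)))) ⟩
    ∑ m (λ i′ → ∑ n (λ j′ → ∑ m (λ i → ∑ n (λ j → F i′ j′ i j))))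
      ≈⟨ ∑-cong m (λ i′ → ∑-comm n m (λ j′ i → ∑ n (F i′ j′ i))) ⟩
    ∑ m (λ i′ → ∑ m (λ i → ∑ n (λ j′ → ∑ n (F i′ j′ i))))
      ≈⟨ ∑-comm m m (λ i′ i → ∑ n (λ j′ → ∑ n (F i′ j′ i))) ⟩
    ∑ m (λ i → ∑ m (λ i′ → ∑ n (λ j′ → ∑ n (F i′ j′ i))))
      ≈⟨ ∑-cong m (λ i → ∑-cong m (λ i′ → ∑-comm n n (λ j′ j → F i′ j′ i j))) ⟩
    ∑ m (λ i → ∑ m (λ i′ → ∑ n (λ j → ∑ n (λ j′ → F i′ j′ i j))))
      ≈⟨ ∑-cong m (λ i → ∑-comm m n (λ i′ j → ∑ n (λ j′ → F i′ j′ i j))) ⟩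
    ∑ m (λ i → ∑ n (λ j → ∑ m (λ i′ → ∑ n (λ j′ → F i′ j′ i j))))
      ≈⟨ ∑-cong m (λ i → ∑-cong n (λ j → ∑-cong m (λ i′ → ∑-cong n (λ j′ →
           rearrange (w i j) (a i′ i) (b j′ j) (x i′) (y j′))))) ⟩
    ∑ m (λ i → ∑ n (λ j → ∑ m (λ i′ → ∑ n (λ j′ → w i j * ((a i′ i * x i′) * (b j′ j * y j′))))))
      ≈⟨ ∑-cong m (λ i → ∑-cong n (λ j → sym (trans (*-distribˡ-∑ _ _ _)
           (∑-cong m (λ i′ → trans (*-congˡ (*-distribˡ-∑ _ _ _)) (*-distribˡ-∑ _ _ _)))))) ⟩
    ∑ m (λ i → ∑ n (λ j → w i j * ∑ m (λ i′ → (a i′ i * x i′) * ∑ n (λ j′ → b j′ j * y j′))))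
      ≈⟨ ∑-cong m (λ i → ∑-cong n (λ j → *-congˡ (sym (*-distribʳ-∑ _ _ _)))) ⟩
    ∑ m (λ i → ∑ n (λ j → w i j * (∑ m (λ i′ → a i′ i * x i′) * ∑ n (λ j′ → b j′ j * y j′))))
      ∎
    where
    F : Fin m → Fin n → Fin m → Fin n → Carrier
    F i′ j′ i j = ((w i j * a i′ i) * b j′ j) * (x i′ * y j′)
    rearrange : ∀ w a b x y → ((w * a) * b) * (x * y) ≈ w * ((a * x) * (b * y))
    rearrange = solve 5 (λ w a b x y → ((w :* a) :* b) :* (x :* y) := w :* ((a :* x) :* (b :* y))) refl

module Frobenius {c ℓ} (R : CommutativeSemiring c ℓ) where

  open CommutativeSemiring R
  open FiniteSums R
  open import Algebra.Properties.Monoid.Sum +-monoid using (sum)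
  open import Algebra.Properties.Semiring.Exp semiring using (_^_)
  open import Algebra.Properties.Monoid.Mult +-monoid using (_×_; ×-congʳ; ×-congˡ; ×-assocˡ; ×-homo-1)
  open import Algebra.Properties.Semiring.Mult semiring using (×-assoc-*)
  import Algebra.Properties.CommutativeSemiring.Binomial R as Binomial
  open import Relation.Binary.Reasoning.Setoid setoid

  ×-zeroʳ : ∀ n → n × 0# ≈ 0#
  ×-zeroʳ zero    = refl
  ×-zeroʳ (suc n) = trans (+-identityˡ _) (×-zeroʳ n)

  0^n≈0 : ∀ {n} → 0 < n → 0# ^ n ≈ 0#
  0^n≈0 {suc n} _ = zeroˡ _

  1^n≈1 : ∀ n → 1# ^ n ≈ 1#
  1^n≈1 zero    = refl
  1^n≈1 (suc n) = trans (*-identityˡ _) (1^n≈1 n)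

  [m*n]×x≈0 : ∀ {n} → n × 1# ≈ 0# → ∀ m x → (m *ℕ n) × x ≈ 0#
  [m*n]×x≈0 {n} n×1≈0 m x = begin
    (m *ℕ n) × x        ≈⟨ sym (×-assocˡ x m n) ⟩
    m × (n × x)         ≈⟨ ×-congʳ m (×-congʳ n (sym (*-identityˡ x))) ⟩
    m × (n × (1# * x))  ≈⟨ ×-congʳ m (sym (×-assoc-* n 1# x)) ⟩
    m × ((n × 1#) * x)  ≈⟨ ×-congʳ m (trans (*-congʳ n×1≈0) (zeroˡ x)) ⟩
    m × 0#              ≈⟨ ×-zeroʳ m ⟩
    0#                  ∎

  module _ {p} (prime : Prime p) (char : p × 1# ≈ 0#) where

    private
      0<p : 0 < p
      0<p = <⇒≤ (nonTrivial⇒n>1 p {{prime⇒nonTrivial prime}})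

    frobenius : ∀ x y → (x + y) ^ p ≈ x ^ p + y ^ p
    frobenius x y = begin
      (x + y) ^ p                 ≈⟨ Binomial.theorem p x y ⟩
      sum {suc p} (λ k → term (toℕ k)) ≡⟨ ≡.trans (sum≡∑ (suc p) _) (∑≡sumℕ (suc p) term) ⟩
      sumℕ (suc p) term           ≈⟨ sumℕ-ends term 0<p inner-terms-vanish ⟩
      term 0 + term p             ≈⟨ +-comm _ _ ⟩
      term p + term 0             ≈⟨ +-cong last-term first-term ⟩
      x ^ p + y ^ p               ∎
      where
      term : ℕ → Carrier
      term k = (p C k) × ((x ^ k) * (y ^ (p ∸ℕ k)))
      last-term : term p ≈ x ^ p
      last-term = begin
        (p C p) × ((x ^ p) * (y ^ (p ∸ℕ p)))
          ≡⟨ ≡.cong₂ (λ n m → n × ((x ^ p) * (y ^ m))) (nCn≡1 p) (ℕₚ.n∸n≡0 p) ⟩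
        1 × ((x ^ p) * 1#)                  ≈⟨ ×-homo-1 _ ⟩
        (x ^ p) * 1#                        ≈⟨ *-identityʳ _ ⟩
        x ^ p                               ∎
      first-term : term 0 ≈ y ^ p
      first-term = trans (×-homo-1 _) (*-identityˡ _)
      inner-terms-vanish : ∀ k → 0 < k → k < p → term k ≈ 0#
      inner-terms-vanish k 0<k k<p with prime∣pCk prime 0<k k<p
      ... | divides m pCk≡m*p =
        trans (×-congˡ pCk≡m*p) ([m*n]×x≈0 char m _)

    frobenius-×1# : ∀ n → (n × 1#) ^ p ≈ n × 1#
    frobenius-×1# zero    = 0^n≈0 0<p
    frobenius-×1# (suc n) = trans (frobenius 1# (n × 1#)) (+-cong (1^n≈1 p) (frobenius-×1# n))

module PolynomialRoots {c ℓ} (R : CommutativeRing c ℓ) where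

  open CommutativeRing R
  open FiniteSums commutativeSemiring
  open import Algebra.Properties.Semiring.Exp semiring using (_^_)
  open import Algebra.Properties.Ring ring using (-1*x≈-x; [y-z]x≈yx-zx)
  open import Algebra.Properties.Group +-group using (x∙y⁻¹≈ε⇒x≈y; x≈y⇒x∙y⁻¹≈ε)
  open import Algebra.Solver.Ring.NaturalCoefficients.Default commutativeSemiring
    using (solve; _:=_; _:+_; _:*_)
  open CommutativeSemigroupProperties *-commutativeSemigroup using ()
    renaming (x∙yz≈y∙xz to x*[y*z]≈y*[x*z]; xy∙z≈y∙xz to [x*y]*z≈y*[x*z])
  open import Relation.Binary.Reasoning.Setoid setoid

  eval : ℕ → (ℕ → Carrier) → Carrier → Carrier
  eval n c u = sumℕ n (λ k → c k * u ^ k)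

  eval-zero : ∀ (c : ℕ → Carrier) u → eval 0 c u ≈ 0#
  eval-zero c u = reflexive (sumℕ-empty _)

  eval-suc : ∀ n (c : ℕ → Carrier) u → eval (suc n) c u ≈ c 0 + u * eval n (λ k → c (suc k)) u
  eval-suc n c u = trans (reflexive (sumℕ-suc n _)) (+-cong (*-identityʳ (c 0)) (begin
    sumℕ n (λ k → c (suc k) * (u * u ^ k)) ≈⟨ sumℕ-cong n (λ k _ → x*[y*z]≈y*[x*z] (c (suc k)) u (u ^ k)) ⟩
    sumℕ n (λ k → u * (c (suc k) * u ^ k)) ≈⟨ sym (*-distribˡ-sumℕ n u (λ k → c (suc k) * u ^ k)) ⟩
    u * eval n (λ k → c (suc k)) u         ∎))

  -- Synthetic division: the coefficients of (c(X) - c(a)) / (X - a), for c of length 1 + n.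
  quotient : Carrier → ℕ → (ℕ → Carrier) → ℕ → Carrier
  quotient a n       c zero    = eval n (λ k → c (suc k)) a
  quotient a zero    c (suc k) = 0#
  quotient a (suc n) c (suc k) = quotient a n (λ k → c (suc k)) k

  -- c(u) - c(a) = (u - a) q(u), with both sides moved so that no subtraction occurs.
  factor-theorem : ∀ n a (c : ℕ → Carrier) u →
    eval (suc n) c u + a * eval n (quotient a n c) u ≈ eval (suc n) c a + u * eval n (quotient a n c) u
  factor-theorem zero a c u = begin
    eval 1 c u + a * q         ≈⟨ +-cong (eval-suc 0 c u) (*-congˡ (eval-zero _ u)) ⟩
    (c 0 + u * c′[u]) + a * 0# ≈⟨ +-cong (+-congˡ (trans (*-congˡ (eval-zero _ u)) (zeroʳ u))) (zeroʳ a) ⟩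
    (c 0 + 0#) + 0#            ≈⟨ +-cong (+-congˡ (sym (trans (*-congˡ (eval-zero _ a)) (zeroʳ a))))
                                         (sym (trans (*-congˡ (eval-zero _ u)) (zeroʳ u))) ⟩
    (c 0 + a * c′[a]) + u * q  ≈⟨ +-congʳ (sym (eval-suc 0 c a)) ⟩
    eval 1 c a + u * q         ∎
    where
    q = eval 0 (quotient a 0 c) u
    c′[u] = eval 0 (λ k → c (suc k)) u
    c′[a] = eval 0 (λ k → c (suc k)) a
  factor-theorem (suc n) a c u = begin
    eval (suc (suc n)) c u + a * eval (suc n) (quotient a (suc n) c) u
      ≈⟨ +-cong (eval-suc (suc n) c u) (*-congˡ (eval-suc n (quotient a (suc n) c) u)) ⟩
    (c 0 + u * rᵤ) + a * (r + u * q)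
      ≈⟨ solve 6 (λ c₀ u a r rᵤ q → (c₀ :+ u :* rᵤ) :+ a :* (r :+ u :* q)
                                 := (c₀ :+ a :* r) :+ u :* (rᵤ :+ a :* q)) refl (c 0) u a r rᵤ q ⟩
    (c 0 + a * r) + u * (rᵤ + a * q)
      ≈⟨ +-congˡ (*-congˡ (factor-theorem n a c′ u)) ⟩
    (c 0 + a * r) + u * (r + u * q)
      ≈⟨ +-cong (sym (eval-suc (suc n) c a)) (*-congˡ (sym (eval-suc n (quotient a (suc n) c) u))) ⟩
    eval (suc (suc n)) c a + u * eval (suc n) (quotient a (suc n) c) u
      ∎
    where
    c′ : ℕ → Carrier
    c′ k = c (suc k)
    rᵤ = eval (suc n) c′ u
    r  = eval (suc n) c′ a
    q  = eval n (quotient a n c′) u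

  quotient-zero⇒coefficients-zero : ∀ n a (c : ℕ → Carrier) → eval (suc n) c a ≈ 0# →
    (∀ k → k < n → quotient a n c k ≈ 0#) → ∀ k → k < suc n → c k ≈ 0#
  quotient-zero⇒coefficients-zero n a c c[a]≈0 q≈0 zero _ = begin
    c 0                            ≈⟨ sym (+-identityʳ _) ⟩
    c 0 + 0#                       ≈⟨ +-congˡ (sym (trans (*-congˡ (tail[a]≈0 n q≈0)) (zeroʳ a))) ⟩
    c 0 + a * eval n (λ k → c (suc k)) a ≈⟨ sym (eval-suc n c a) ⟩
    eval (suc n) c a               ≈⟨ c[a]≈0 ⟩
    0#                             ∎
    where
    tail[a]≈0 : ∀ n → (∀ k → k < n → quotient a n c k ≈ 0#) → eval n (λ k → c (suc k)) a ≈ 0#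
    tail[a]≈0 zero    _   = eval-zero _ a
    tail[a]≈0 (suc n) q≈0 = q≈0 0 (s≤s z≤n)
  quotient-zero⇒coefficients-zero (suc n) a c _ q≈0 (suc k) (s≤s k<1+n) =
    quotient-zero⇒coefficients-zero n a (λ k → c (suc k)) (q≈0 0 (s≤s z≤n))
      (λ k k<n → q≈0 (suc k) (s≤s k<n)) k k<1+n

  eval-difference : ∀ n (f g : ℕ → Carrier) u → eval n (λ k → f k - g k) u ≈ eval n f u - eval n g u
  eval-difference n f g u = begin
    sumℕ n (λ k → (f k - g k) * u ^ k)
      ≈⟨ sumℕ-cong n (λ k _ → trans ([y-z]x≈yx-zx _ _ _) (+-congˡ (sym (-1*x≈-x _)))) ⟩
    sumℕ n (λ k → f k * u ^ k + - 1# * (g k * u ^ k))    ≈⟨ sumℕ-distrib-+ n _ _ ⟩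
    eval n f u + sumℕ n (λ k → - 1# * (g k * u ^ k))     ≈⟨ +-congˡ (sym (*-distribˡ-sumℕ n (- 1#) _)) ⟩
    eval n f u + - 1# * eval n g u                       ≈⟨ +-congˡ (-1*x≈-x _) ⟩
    eval n f u - eval n g u                              ∎

  module _ (inverse : ∀ x → ¬ (x ≈ 0#) → ∃ λ y → x * y ≈ 1#) where

    nonzero*x≈0⇒x≈0 : ∀ {z x} → ¬ (z ≈ 0#) → z * x ≈ 0# → x ≈ 0#
    nonzero*x≈0⇒x≈0 {z} {x} z≉0 zx≈0 with inverse z z≉0
    ... | z⁻¹ , zz⁻¹≈1 = begin
      x                 ≈⟨ sym (*-identityˡ x) ⟩
      1# * x            ≈⟨ *-congʳ (sym zz⁻¹≈1) ⟩
      (z * z⁻¹) * x     ≈⟨ [x*y]*z≈y*[x*z] z z⁻¹ x ⟩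
      z⁻¹ * (z * x)     ≈⟨ *-congˡ zx≈0 ⟩
      z⁻¹ * 0#          ≈⟨ zeroʳ z⁻¹ ⟩
      0#                ∎

    *-cancelʳ-nonzero : ∀ {x y z} → ¬ (z ≈ 0#) → x * z ≈ y * z → x ≈ y
    *-cancelʳ-nonzero {x} {y} {z} z≉0 xz≈yz = x∙y⁻¹≈ε⇒x≈y x y (nonzero*x≈0⇒x≈0 z≉0 (begin
      z * (x - y)       ≈⟨ *-comm z (x - y) ⟩
      (x - y) * z       ≈⟨ [y-z]x≈yx-zx z x y ⟩
      x * z - y * z     ≈⟨ x≈y⇒x∙y⁻¹≈ε xz≈yz ⟩
      0#                ∎))

    roots⇒coefficients-zero : ∀ n (c x : ℕ → Carrier) →
      (∀ {i j} → i < n → j < n → x i ≈ x j → i ≡ j) →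
      (∀ i → i < n → eval n c (x i) ≈ 0#) → ∀ k → k < n → c k ≈ 0#
    roots⇒coefficients-zero (suc n) c x distinct roots =
      quotient-zero⇒coefficients-zero n a c (roots 0 (s≤s z≤n))
        (roots⇒coefficients-zero n (quotient a n c) (λ i → x (suc i)) distinct′ quotient-roots)
      where
      a = x 0
      distinct′ : ∀ {i j} → i < n → j < n → x (suc i) ≈ x (suc j) → i ≡ j
      distinct′ i<n j<n e = ℕₚ.suc-injective (distinct (s≤s i<n) (s≤s j<n) e)
      quotient-roots : ∀ i → i < n → eval n (quotient a n c) (x (suc i)) ≈ 0#
      quotient-roots i i<n =
        nonzero*x≈0⇒x≈0 (xᵢ≉a ∘ x∙y⁻¹≈ε⇒x≈y xᵢ a) (trans ([y-z]x≈yx-zx q xᵢ a) (x≈y⇒x∙y⁻¹≈ε xᵢq≈aq))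
        where
        xᵢ = x (suc i)
        q = eval n (quotient a n c) xᵢ
        xᵢ≉a : ¬ (xᵢ ≈ a)
        xᵢ≉a e with distinct (s≤s i<n) (s≤s z≤n) e
        ... | ()
        xᵢq≈aq : xᵢ * q ≈ a * q
        xᵢq≈aq = begin
          xᵢ * q                      ≈⟨ sym (+-identityˡ _) ⟩
          0# + xᵢ * q                 ≈⟨ +-congʳ (sym (roots 0 (s≤s z≤n))) ⟩
          eval (suc n) c a + xᵢ * q   ≈⟨ sym (factor-theorem n a c xᵢ) ⟩
          eval (suc n) c xᵢ + a * q   ≈⟨ +-congʳ (roots (suc i) (s≤s i<n)) ⟩
          0# + a * q                  ≈⟨ +-identityˡ _ ⟩
          a * q                       ∎

    agree⇒coefficients-equal : ∀ n (f g x : ℕ → Carrier) →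
      (∀ {i j} → i < n → j < n → x i ≈ x j → i ≡ j) →
      (∀ i → i < n → eval n f (x i) ≈ eval n g (x i)) → ∀ k → k < n → f k ≈ g k
    agree⇒coefficients-equal n f g x distinct agree k k<n =
      x∙y⁻¹≈ε⇒x≈y _ _ (roots⇒coefficients-zero n (λ k → f k - g k) x distinct
        (λ i i<n → trans (eval-difference n f g (x i)) (x≈y⇒x∙y⁻¹≈ε (agree i i<n))) k k<n)

module HomogeneousPolynomials {ℓ₁ ℓ₂ p} (K : AlgClosureFp p ℓ₁ ℓ₂) where

  open AlgClosureFp K
  open Setup K
  open FiniteSums commutativeSemiring
  open import Algebra.Properties.Semiring.Exp semiring using (^-homo-*; ^-congˡ)
  open import Algebra.Properties.CommutativeSemiring.Exp commutativeSemiring using (^-distrib-*)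
  open CommutativeSemigroupProperties *-commutativeSemigroup using ()
    renaming (interchange to *-interchange; x∙yz≈y∙xz to x*[y*z]≈y*[x*z])
  open import Relation.Binary.Reasoning.Setoid setoid

  coef-toℕ : ∀ {n} (f : HP n) i → coef f (toℕ i) ≡ f i
  coef-toℕ {n} f i with toℕ i <? suc n
  ... | yes i<1+n = cong f (fromℕ<-toℕ i i<1+n)
  ... | no  i≮1+n = contradiction (toℕ<n i) i≮1+n

  coef-fromℕ< : ∀ {n} (f : HP n) {k} (k<1+n : k < suc n) → coef f k ≡ f (fromℕ< k<1+n)
  coef-fromℕ< {n} f {k} k<1+n with k <? suc n
  ... | yes k<1+n′ = cong f (fromℕ<-cong k k ≡.refl k<1+n′ k<1+n)
  ... | no  k≮1+n = contradiction k<1+n k≮1+n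

  coef-> : ∀ {n} (f : HP n) {k} → n < k → coef f k ≡ 0#
  coef-> {n} f {k} n<k with k <? suc n
  ... | yes k<1+n = contradiction (≤-trans n<k (ℕₚ.≤-pred k<1+n)) (<-irrefl ≡.refl)
  ... | no  _     = ≡.refl

  coef-zero : ∀ {n} (f : HP n) k → (∀ i → f i ≈ 0#) → coef f k ≈ 0#
  coef-zero {n} f k f≈0 with k <? suc n
  ... | yes _ = f≈0 _
  ... | no  _ = refl

  shift : ℕ → (ℕ → Carrier) → ℕ → Carrier
  shift zero    g k       = g k
  shift (suc j) g zero    = 0#
  shift (suc j) g (suc k) = shift j g k

  shift-≥ : ∀ j g {k} → j ≤ k → shift j g k ≡ g (k ∸ℕ j)
  shift-≥ zero    g _         = ≡.refl
  shift-≥ (suc j) g (s≤s j≤k) = shift-≥ j g j≤k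

  shift-< : ∀ j g {k} → k < j → shift j g k ≡ 0#
  shift-< (suc j) g {zero}  _         = ≡.refl
  shift-< (suc j) g {suc k} (s≤s k<j) = shift-< j g k<j

  sumℕ-shift : ∀ j n (g h : ℕ → Carrier) →
    sumℕ (j +ℕ n) (λ k → shift j g k * h k) ≈ sumℕ n (λ l → g l * h (j +ℕ l))
  sumℕ-shift zero    n g h = refl
  sumℕ-shift (suc j) n g h = begin
    sumℕ (suc (j +ℕ n)) (λ k → shift (suc j) g k * h k)
      ≡⟨ sumℕ-suc (j +ℕ n) _ ⟩
    0# * h 0 + sumℕ (j +ℕ n) (λ k → shift j g k * h (suc k))
      ≈⟨ +-cong (zeroˡ (h 0)) (sumℕ-shift j n g (λ k → h (suc k))) ⟩
    0# + sumℕ n (λ l → g l * h (suc (j +ℕ l)))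
      ≈⟨ +-identityˡ _ ⟩
    sumℕ n (λ l → g l * h (suc (j +ℕ l)))
      ∎

  ⊛-coefficient : ∀ {m n} (f : HP m) (g : HP n) i →
    (f ⊛ g) i ≈ sumℕ (suc m) (λ j → coef f j * shift j (coef g) (toℕ i))

  -- The left-hand side, a summand of _⊛_ given by a local function of Defs that cannot be
  -- named, is solved from the use below.  The summand for j = 0 computes and is treated there.
  ⊛-summand-suc : ∀ {m n} (f : HP m) (g : HP n) i (j : Fin m) →
    _ ≈ coef f (suc (toℕ j)) * shift (suc (toℕ j)) (coef g) (toℕ i)

  ⊛-coefficient {m} f g i = begin
    (f ⊛ g) i
      ≈⟨ +-cong (*-congʳ (reflexive (≡.sym (coef-toℕ f Fin.zero))))
                (trans (reflexive (sum≡∑ m _)) (∑-cong m (⊛-summand-suc f g i))) ⟩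
    coef f 0 * coef g (toℕ i) + ∑ m (λ j → h (suc (toℕ j)))
      ≡⟨ ≡.trans (cong (h 0 +_) (∑≡sumℕ m (λ k → h (suc k)))) (≡.sym (sumℕ-suc m h)) ⟩
    sumℕ (suc m) h
      ∎
    where
    h : ℕ → Carrier
    h j = coef f j * shift j (coef g) (toℕ i)

  ⊛-summand-suc f g i j with toℕ (Fin.suc j) <? suc (toℕ i)
  ... | yes (s≤s j<i) =
    sym (*-cong (reflexive (coef-toℕ f (Fin.suc j))) (reflexive (shift-≥ (suc (toℕ j)) (coef g) j<i)))
  ... | no  j≮i       =
    sym (trans (*-congˡ (reflexive (shift-< (suc (toℕ j)) (coef g) (ℕₚ.≰⇒> (j≮i ∘ s≤s))))) (zeroʳ _))

  coef-⊛ : ∀ {m n} (f : HP m) (g : HP n) {k} → k < suc (m +ℕ n) →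
    coef (f ⊛ g) k ≈ sumℕ (suc m) (λ j → coef f j * shift j (coef g) k)
  coef-⊛ f g {k} k<1+m+n = trans (reflexive (coef-fromℕ< (f ⊛ g) k<1+m+n))
    (trans (⊛-coefficient f g (fromℕ< k<1+m+n))
           (reflexive (cong (λ l → sumℕ _ (λ j → coef f j * shift j (coef g) l)) (toℕ-fromℕ< k<1+m+n))))

  monomial : ℕ → Carrier → Carrier → ℕ → Carrier
  monomial d u v k = (u ^ k) * (v ^ (d ∸ℕ k))

  monomial-cong : ∀ d {u u′ v v′} → u ≈ u′ → v ≈ v′ → ∀ k → monomial d u v k ≈ monomial d u′ v′ k
  monomial-cong d u≈u′ v≈v′ k = *-cong (^-congˡ k u≈u′) (^-congˡ (d ∸ℕ k) v≈v′)

  monomial-+ : ∀ {j l m n} u v → j ≤ m → l ≤ n →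
    monomial (m +ℕ n) u v (j +ℕ l) ≈ monomial m u v j * monomial n u v l
  monomial-+ {j} {l} u v j≤m l≤n with ℕₚ.m≤n⇒∃[o]m+o≡n j≤m | ℕₚ.m≤n⇒∃[o]m+o≡n l≤n
  ... | a , ≡.refl | b , ≡.refl = begin
    (u ^ (j +ℕ l)) * (v ^ ((j +ℕ a) +ℕ (l +ℕ b) ∸ℕ (j +ℕ l)))
      ≡⟨ cong (λ e → (u ^ (j +ℕ l)) * (v ^ e)) [j+a]+[l+b]∸[j+l]≡a+b ⟩
    (u ^ (j +ℕ l)) * (v ^ (a +ℕ b))
      ≈⟨ *-cong (^-homo-* u j l) (^-homo-* v a b) ⟩
    ((u ^ j) * (u ^ l)) * ((v ^ a) * (v ^ b))
      ≈⟨ *-interchange (u ^ j) (u ^ l) (v ^ a) (v ^ b) ⟩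
    ((u ^ j) * (v ^ a)) * ((u ^ l) * (v ^ b))
      ≡⟨ ≡.cong₂ (λ e e′ → ((u ^ j) * (v ^ e)) * ((u ^ l) * (v ^ e′)))
                 (≡.sym (ℕₚ.m+n∸m≡n j a)) (≡.sym (ℕₚ.m+n∸m≡n l b)) ⟩
    monomial (j +ℕ a) u v j * monomial (l +ℕ b) u v l
      ∎
    where
    [j+a]+[l+b]∸[j+l]≡a+b : (j +ℕ a) +ℕ (l +ℕ b) ∸ℕ (j +ℕ l) ≡ a +ℕ b
    [j+a]+[l+b]∸[j+l]≡a+b =
      ≡.trans (cong (_∸ℕ (j +ℕ l)) (+-interchange j a l b)) (ℕₚ.m+n∸m≡n (j +ℕ l) (a +ℕ b))

  -- The degree d is separate from the index of f so that equations between degrees can be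
  -- applied to d alone.
  evalHP : ∀ {n} → ℕ → HP n → Carrier → Carrier → Carrier
  evalHP d f u v = sumℕ (suc d) (λ k → coef f k * monomial d u v k)

  evalHP-shift : ∀ {m n} (g : HP n) u v {j} → j ≤ m →
    sumℕ (suc (m +ℕ n)) (λ k → shift j (coef g) k * monomial (m +ℕ n) u v k)
      ≈ monomial m u v j * evalHP n g u v
  evalHP-shift {n = n} g u v {j} j≤m with ℕₚ.m≤n⇒∃[o]m+o≡n j≤m
  ... | a , ≡.refl = begin
    sumℕ (suc (j +ℕ a +ℕ n)) (λ k → shift j (coef g) k * mon k)
      ≡⟨ cong (λ l → sumℕ l (λ k → shift j (coef g) k * mon k)) 1+[j+a+n]≡j+[1+n+a] ⟩
    sumℕ (j +ℕ (suc n +ℕ a)) (λ k → shift j (coef g) k * mon k)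
      ≈⟨ sumℕ-shift j (suc n +ℕ a) (coef g) mon ⟩
    sumℕ (suc n +ℕ a) (λ l → coef g l * mon (j +ℕ l))
      ≈⟨ sym (sumℕ-extend _ (m≤m+n (suc n) a) (λ l n<l → trans (*-congʳ (reflexive (coef-> g n<l))) (zeroˡ _))) ⟩
    sumℕ (suc n) (λ l → coef g l * mon (j +ℕ l))
      ≈⟨ sumℕ-cong (suc n) (λ l l<1+n → *-congˡ (monomial-+ u v (m≤m+n j a) (ℕₚ.≤-pred l<1+n))) ⟩
    sumℕ (suc n) (λ l → coef g l * (monomial (j +ℕ a) u v j * monomial n u v l))
      ≈⟨ sumℕ-cong (suc n) (λ l _ → x*[y*z]≈y*[x*z] _ _ _) ⟩
    sumℕ (suc n) (λ l → monomial (j +ℕ a) u v j * (coef g l * monomial n u v l))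
      ≈⟨ sym (*-distribˡ-sumℕ (suc n) _ _) ⟩
    monomial (j +ℕ a) u v j * evalHP n g u v
      ∎
    where
    mon = monomial (j +ℕ a +ℕ n) u v
    1+[j+a+n]≡j+[1+n+a] : suc (j +ℕ a +ℕ n) ≡ j +ℕ (suc n +ℕ a)
    1+[j+a+n]≡j+[1+n+a] = ≡.trans (cong suc (≡.trans (ℕₚ.+-assoc j a n) (cong (j +ℕ_) (ℕₚ.+-comm a n))))
                                  (≡.sym (ℕₚ.+-suc j (n +ℕ a)))

  evalHP-⊛ : ∀ {m n} (f : HP m) (g : HP n) u v →
    evalHP (m +ℕ n) (f ⊛ g) u v ≈ evalHP m f u v * evalHP n g u v
  evalHP-⊛ {m} {n} f g u v = begin
    sumℕ (suc (m +ℕ n)) (λ k → coef (f ⊛ g) k * mon k)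
      ≈⟨ sumℕ-cong (suc (m +ℕ n)) (λ k k< → trans (*-congʳ (coef-⊛ f g k<)) (*-distribʳ-sumℕ (suc m) _ _)) ⟩
    sumℕ (suc (m +ℕ n)) (λ k → sumℕ (suc m) (λ j → (coef f j * shift j (coef g) k) * mon k))
      ≈⟨ sumℕ-comm (suc (m +ℕ n)) (suc m) _ ⟩
    sumℕ (suc m) (λ j → sumℕ (suc (m +ℕ n)) (λ k → (coef f j * shift j (coef g) k) * mon k))
      ≈⟨ sumℕ-cong (suc m) (λ j j<1+m → begin
           sumℕ (suc (m +ℕ n)) (λ k → (coef f j * shift j (coef g) k) * mon k)
             ≈⟨ sumℕ-cong (suc (m +ℕ n)) (λ k _ → *-assoc _ _ _) ⟩
           sumℕ (suc (m +ℕ n)) (λ k → coef f j * (shift j (coef g) k * mon k))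
             ≈⟨ sym (*-distribˡ-sumℕ (suc (m +ℕ n)) _ _) ⟩
           coef f j * sumℕ (suc (m +ℕ n)) (λ k → shift j (coef g) k * mon k)
             ≈⟨ *-congˡ (evalHP-shift g u v (ℕₚ.≤-pred j<1+m)) ⟩
           coef f j * (monomial m u v j * evalHP n g u v)
             ≈⟨ sym (*-assoc _ _ _) ⟩
           (coef f j * monomial m u v j) * evalHP n g u v
             ∎) ⟩
    sumℕ (suc m) (λ j → (coef f j * monomial m u v j) * evalHP n g u v)
      ≈⟨ sym (*-distribʳ-sumℕ (suc m) _ _) ⟩
    evalHP m f u v * evalHP n g u v
      ∎
    where
    mon = monomial (m +ℕ n) u v

  evalHP-lin : ∀ α β u v → evalHP 1 (lin α β) u v ≈ α * u + β * v
  evalHP-lin α β u v = begin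
    evalHP 1 (lin α β) u v
      ≡⟨ ≡.trans (sumℕ-suc 1 _) (cong (_ +_) (≡.trans (sumℕ-suc 0 _) (cong (_ +_) (sumℕ-empty _)))) ⟩
    β * (1# * (v * 1#)) + (α * ((u * 1#) * 1#) + 0#)
      ≈⟨ +-cong (*-congˡ (trans (*-identityˡ _) (*-identityʳ v)))
                (trans (+-identityʳ _) (*-congˡ (trans (*-identityʳ _) (*-identityʳ u)))) ⟩
    β * v + α * u
      ≈⟨ +-comm _ _ ⟩
    α * u + β * v
      ∎

  evalHP-pow : ∀ L k u v → evalHP k (pow L k) u v ≈ evalHP 1 L u v ^ k
  evalHP-pow L zero    u v = begin
    evalHP 0 (pow L 0) u v   ≡⟨ ≡.trans (sumℕ-suc 0 _) (cong (_ +_) (sumℕ-empty _)) ⟩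
    1# * (1# * 1#) + 0#      ≈⟨ trans (+-identityʳ _) (trans (*-identityˡ _) (*-identityˡ _)) ⟩
    1#                       ∎
  evalHP-pow L (suc k) u v = trans (evalHP-⊛ L (pow L k) u v) (*-congˡ (evalHP-pow L k u v))

  symMat-column : ∀ r α β γ δ (i : Fin (suc r)) u v →
    sum (λ i′ → symMat r α β γ δ i′ i * monomial r u v (toℕ i′))
      ≈ ((α * u + β * v) ^ toℕ i) * ((γ * u + δ * v) ^ (r ∸ℕ toℕ i))
  symMat-column r α β γ δ i u v = begin
    sum (λ i′ → symMat r α β γ δ i′ i * monomial r u v (toℕ i′))
      ≡⟨ ≡.trans (sum≡∑ (suc r) _) (∑≡sumℕ (suc r) (λ k → coef F k * monomial r u v k)) ⟩
    evalHP r F u v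
      ≡⟨ cong (λ d → evalHP d F u v) (≡.sym (m+[n∸m]≡n (ℕₚ.≤-pred (toℕ<n i)))) ⟩
    evalHP (toℕ i +ℕ (r ∸ℕ toℕ i)) F u v
      ≈⟨ evalHP-⊛ (pow (lin α β) (toℕ i)) (pow (lin γ δ) (r ∸ℕ toℕ i)) u v ⟩
    evalHP (toℕ i) (pow (lin α β) (toℕ i)) u v * evalHP (r ∸ℕ toℕ i) (pow (lin γ δ) (r ∸ℕ toℕ i)) u v
      ≈⟨ *-cong (trans (evalHP-pow _ _ u v) (^-congˡ (toℕ i) (evalHP-lin α β u v)))
                (trans (evalHP-pow _ _ u v) (^-congˡ (r ∸ℕ toℕ i) (evalHP-lin γ δ u v))) ⟩
    ((α * u + β * v) ^ toℕ i) * ((γ * u + δ * v) ^ (r ∸ℕ toℕ i))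
      ∎
    where
    F = pow (lin α β) (toℕ i) ⊛ pow (lin γ δ) (r ∸ℕ toℕ i)

  monomial-scale : ∀ d x u v {k} → k ≤ d → monomial d (x * u) (x * v) k ≈ (x ^ d) * monomial d u v k
  monomial-scale d x u v {k} k≤d = begin
    ((x * u) ^ k) * ((x * v) ^ (d ∸ℕ k))
      ≈⟨ *-cong (^-distrib-* x u k) (^-distrib-* x v (d ∸ℕ k)) ⟩
    ((x ^ k) * (u ^ k)) * ((x ^ (d ∸ℕ k)) * (v ^ (d ∸ℕ k)))
      ≈⟨ *-interchange _ _ _ _ ⟩
    ((x ^ k) * (x ^ (d ∸ℕ k))) * monomial d u v k
      ≈⟨ *-congʳ (sym (^-homo-* x k (d ∸ℕ k))) ⟩
    (x ^ (k +ℕ (d ∸ℕ k))) * monomial d u v k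
      ≡⟨ cong (λ e → (x ^ e) * monomial d u v k) (m+[n∸m]≡n k≤d) ⟩
    (x ^ d) * monomial d u v k
      ∎

module PsiProperties {ℓ₁ ℓ₂ p} (prime : Prime p) (K : AlgClosureFp p ℓ₁ ℓ₂) where

  open AlgClosureFp K
  open Setup K
  open FiniteSums commutativeSemiring
  open Frobenius commutativeSemiring using (frobenius; 1^n≈1)
  open PolynomialRoots commRing using (eval)
  open HomogeneousPolynomials K
  open import Algebra.Properties.Semiring.Exp semiring using (^-homo-*; ^-congˡ; ^-assocʳ)
  open import Algebra.Properties.CommutativeSemiring.Exp commutativeSemiring using (^-distrib-*)
  open CommutativeSemigroupProperties *-commutativeSemigroup using ()
    renaming (interchange to *-interchange; x∙yz≈y∙xz to x*[y*z]≈y*[x*z])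
  open import Relation.Binary.Reasoning.Setoid setoid

  private instance
    p≢0 : NonZero p
    p≢0 = prime⇒nonZero prime

  basisImage : ∀ r s → Fin (suc r) → Fin (suc s) → Carrier → Carrier → Carrier
  basisImage r s i j u v = monomial r u v (toℕ i) * monomial s (u ^ p) (v ^ p) (toℕ j)

  Ψ≈∑∑ : ∀ r s (w : V r s) u v →
         Ψ r s w u v ≈ ∑ (suc r) (λ i → ∑ (suc s) (λ j → w i j * basisImage r s i j u v))
  Ψ≈∑∑ r s w u v = sum²≈∑² (suc r) (suc s) _

  Ψ-+ : ∀ r s (w w′ : V r s) u v → Ψ r s (w +V w′) u v ≈ Ψ r s w u v + Ψ r s w′ u v
  Ψ-+ r s w w′ u v = begin
    Ψ r s (w +V w′) u v
      ≈⟨ Ψ≈∑∑ r s (w +V w′) u v ⟩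
    ∑ (suc r) (λ i → ∑ (suc s) (λ j → (w i j + w′ i j) * e i j))
      ≈⟨ ∑-cong (suc r) (λ i → trans (∑-cong (suc s) (λ j → distribʳ _ _ _)) (∑-distrib-+ (suc s) _ _)) ⟩
    ∑ (suc r) (λ i → ∑ (suc s) (λ j → w i j * e i j) + ∑ (suc s) (λ j → w′ i j * e i j))
      ≈⟨ ∑-distrib-+ (suc r) _ _ ⟩
    ∑ (suc r) (λ i → ∑ (suc s) (λ j → w i j * e i j)) + ∑ (suc r) (λ i → ∑ (suc s) (λ j → w′ i j * e i j))
      ≈⟨ sym (+-cong (Ψ≈∑∑ r s w u v) (Ψ≈∑∑ r s w′ u v)) ⟩
    Ψ r s w u v + Ψ r s w′ u v
      ∎
    where
    e = λ i j → basisImage r s i j u v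

  Ψ-* : ∀ r s λ′ (w : V r s) u v → Ψ r s (λ′ ·V w) u v ≈ λ′ * Ψ r s w u v
  Ψ-* r s λ′ w u v = begin
    Ψ r s (λ′ ·V w) u v
      ≈⟨ Ψ≈∑∑ r s (λ′ ·V w) u v ⟩
    ∑ (suc r) (λ i → ∑ (suc s) (λ j → (λ′ * w i j) * e i j))
      ≈⟨ ∑-cong (suc r) (λ i → trans (∑-cong (suc s) (λ j → *-assoc _ _ _)) (sym (*-distribˡ-∑ (suc s) _ _))) ⟩
    ∑ (suc r) (λ i → λ′ * ∑ (suc s) (λ j → w i j * e i j))
      ≈⟨ sym (*-distribˡ-∑ (suc r) _ _) ⟩
    λ′ * ∑ (suc r) (λ i → ∑ (suc s) (λ j → w i j * e i j))
      ≈⟨ *-congˡ (sym (Ψ≈∑∑ r s w u v)) ⟩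
    λ′ * Ψ r s w u v
      ∎
    where
    e = λ i j → basisImage r s i j u v

  basisImage-scale : ∀ r s i j x u v →
    basisImage r s i j (x * u) (x * v) ≈ (x ^ (r +ℕ p *ℕ s)) * basisImage r s i j u v
  basisImage-scale r s i j x u v = begin
    monomial r (x * u) (x * v) (toℕ i) * monomial s ((x * u) ^ p) ((x * v) ^ p) (toℕ j)
      ≈⟨ *-cong (monomial-scale r x u v (ℕₚ.≤-pred (toℕ<n i)))
                (trans (monomial-cong s (^-distrib-* x u p) (^-distrib-* x v p) (toℕ j))
                       (monomial-scale s (x ^ p) (u ^ p) (v ^ p) (ℕₚ.≤-pred (toℕ<n j)))) ⟩
    ((x ^ r) * monomial r u v (toℕ i)) * (((x ^ p) ^ s) * monomial s (u ^ p) (v ^ p) (toℕ j))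
      ≈⟨ *-interchange _ _ _ _ ⟩
    ((x ^ r) * ((x ^ p) ^ s)) * basisImage r s i j u v
      ≈⟨ *-congʳ (trans (*-congˡ (^-assocʳ x p s)) (sym (^-homo-* x r (p *ℕ s)))) ⟩
    (x ^ (r +ℕ p *ℕ s)) * basisImage r s i j u v
      ∎

  Ψ-homogeneous : ∀ r s (w : V r s) x u v → Ψ r s w (x * u) (x * v) ≈ (x ^ (r +ℕ p *ℕ s)) * Ψ r s w u v
  Ψ-homogeneous r s w x u v = begin
    Ψ r s w (x * u) (x * v)
      ≈⟨ Ψ≈∑∑ r s w (x * u) (x * v) ⟩
    ∑ (suc r) (λ i → ∑ (suc s) (λ j → w i j * basisImage r s i j (x * u) (x * v)))
      ≈⟨ ∑-cong (suc r) (λ i → trans (∑-cong (suc s) (λ j →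
           trans (*-congˡ (basisImage-scale r s i j x u v)) (x*[y*z]≈y*[x*z] _ _ _)))
           (sym (*-distribˡ-∑ (suc s) _ _))) ⟩
    ∑ (suc r) (λ i → xᵈ * ∑ (suc s) (λ j → w i j * basisImage r s i j u v))
      ≈⟨ sym (*-distribˡ-∑ (suc r) _ _) ⟩
    xᵈ * ∑ (suc r) (λ i → ∑ (suc s) (λ j → w i j * basisImage r s i j u v))
      ≈⟨ *-congˡ (sym (Ψ≈∑∑ r s w u v)) ⟩
    xᵈ * Ψ r s w u v
      ∎
    where
    xᵈ = x ^ (r +ℕ p *ℕ s)

  Ψ-equivariant : ∀ r s q t (M : GL2) (w : V r s) u v →
    Ψ r s (actV r s q t M w) u v ≈ actU (q +ℕ p *ℕ t) M (Ψ r s w) u v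
  Ψ-equivariant r s q t M w u v = begin
    Ψ r s (actV r s q t M w) u v
      ≈⟨ Ψ≈∑∑ r s _ u v ⟩
    ∑ (suc r) (λ i′ → ∑ (suc s) (λ j′ → (D * sum (λ i → sum (λ j → T i′ j′ i j))) * basisImage r s i′ j′ u v))
      ≈⟨ ∑-cong (suc r) (λ i′ → ∑-cong (suc s) (λ j′ →
           trans (*-assoc _ _ _) (*-congˡ (*-congʳ (sum²≈∑² (suc r) (suc s) (T i′ j′)))))) ⟩
    ∑ (suc r) (λ i′ → ∑ (suc s) (λ j′ → D * (∑ (suc r) (λ i → ∑ (suc s) (T i′ j′ i)) * basisImage r s i′ j′ u v)))
      ≈⟨ trans (∑-cong (suc r) (λ i′ → sym (*-distribˡ-∑ (suc s) _ _))) (sym (*-distribˡ-∑ (suc r) _ _)) ⟩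
    D * ∑ (suc r) (λ i′ → ∑ (suc s) (λ j′ → ∑ (suc r) (λ i → ∑ (suc s) (T i′ j′ i)) * basisImage r s i′ j′ u v))
      ≈⟨ *-congˡ (∑∑-change-of-basis w A B (λ i′ → monomial r u v (toℕ i′))
                                            (λ j′ → monomial s (u ^ p) (v ^ p) (toℕ j′))) ⟩
    D * ∑ (suc r) (λ i → ∑ (suc s) (λ j → w i j * (∑ (suc r) (λ i′ → A i′ i * monomial r u v (toℕ i′))
                                                   * ∑ (suc s) (λ j′ → B j′ j * monomial s (u ^ p) (v ^ p) (toℕ j′)))))
      ≈⟨ *-congˡ (∑-cong (suc r) (λ i → ∑-cong (suc s) (λ j →
           *-congˡ (*-cong (first-factor i) (second-factor j))))) ⟩
    D * ∑ (suc r) (λ i → ∑ (suc s) (λ j → w i j * basisImage r s i j U′ V′))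
      ≈⟨ *-congˡ (sym (Ψ≈∑∑ r s w U′ V′)) ⟩
    actU (q +ℕ p *ℕ t) M (Ψ r s w) u v
      ∎
    where
    open GL2 M
    D = det ^ (q +ℕ p *ℕ t)
    U′ = a * u + b * v
    V′ = c * u + d * v
    A = symMat r a b c d
    B = symMat s (a ^ p) (b ^ p) (c ^ p) (d ^ p)
    T = λ i′ j′ i j → (w i j * A i′ i) * B j′ j
    frobenius-lin : ∀ α β → (α ^ p) * (u ^ p) + (β ^ p) * (v ^ p) ≈ (α * u + β * v) ^ p
    frobenius-lin α β =
      sym (trans (frobenius prime char-p (α * u) (β * v)) (+-cong (^-distrib-* α u p) (^-distrib-* β v p)))
    first-factor : ∀ i → ∑ (suc r) (λ i′ → A i′ i * monomial r u v (toℕ i′)) ≈ monomial r U′ V′ (toℕ i)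
    first-factor i = trans (reflexive (≡.sym (sum≡∑ (suc r) _))) (symMat-column r a b c d i u v)
    second-factor : ∀ j → ∑ (suc s) (λ j′ → B j′ j * monomial s (u ^ p) (v ^ p) (toℕ j′))
                            ≈ monomial s (U′ ^ p) (V′ ^ p) (toℕ j)
    second-factor j = trans (reflexive (≡.sym (sum≡∑ (suc s) _)))
      (trans (symMat-column s (a ^ p) (b ^ p) (c ^ p) (d ^ p) j (u ^ p) (v ^ p))
             (monomial-cong s (frobenius-lin a b) (frobenius-lin c d) (toℕ j)))

  entry : ∀ {r s} → V r s → ℕ → ℕ → Carrier
  entry w a b = coef (λ i → coef (w i) b) a

  entry-toℕ : ∀ {r s} (w : V r s) i j → entry w (toℕ i) (toℕ j) ≡ w i j
  entry-toℕ w i j = ≡.trans (coef-toℕ (λ i → coef (w i) (toℕ j)) i) (coef-toℕ (w i) j)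

  -- For r, s < p this is the coefficient of u^e in Ψ w (u, 1), read off the base-p digits of e.
  digitEntry : ∀ {r s} → V r s → ℕ → Carrier
  digitEntry w e = entry w (e % p) (e / p)

  basisImage-at-1 : ∀ r s i j u → basisImage r s i j u 1# ≈ u ^ (toℕ i +ℕ toℕ j *ℕ p)
  basisImage-at-1 r s i j u = begin
    ((u ^ toℕ i) * (1# ^ (r ∸ℕ toℕ i))) * (((u ^ p) ^ toℕ j) * ((1# ^ p) ^ (s ∸ℕ toℕ j)))
      ≈⟨ *-cong (*-congˡ (1^n≈1 (r ∸ℕ toℕ i)))
                (*-congˡ (trans (^-congˡ (s ∸ℕ toℕ j) (1^n≈1 p)) (1^n≈1 (s ∸ℕ toℕ j)))) ⟩
    ((u ^ toℕ i) * 1#) * (((u ^ p) ^ toℕ j) * 1#)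
      ≈⟨ *-cong (*-identityʳ _) (trans (*-identityʳ _) (^-assocʳ u p (toℕ j))) ⟩
    (u ^ toℕ i) * (u ^ (p *ℕ toℕ j))
      ≈⟨ sym (^-homo-* u (toℕ i) (p *ℕ toℕ j)) ⟩
    u ^ (toℕ i +ℕ p *ℕ toℕ j)
      ≡⟨ cong (λ e → u ^ (toℕ i +ℕ e)) (ℕₚ.*-comm p (toℕ j)) ⟩
    u ^ (toℕ i +ℕ toℕ j *ℕ p)
      ∎

  Ψ-at-1 : ∀ {r s} → r < p → s < p → (w : V r s) → ∀ u → Ψ r s w u 1# ≈ eval (p *ℕ p) (digitEntry w) u
  Ψ-at-1 {r} {s} r<p s<p w u = begin
    Ψ r s w u 1#
      ≈⟨ Ψ≈∑∑ r s w u 1# ⟩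
    ∑ (suc r) (λ i → ∑ (suc s) (λ j → w i j * basisImage r s i j u 1#))
      ≈⟨ ∑-cong (suc r) (λ i → ∑-cong (suc s) (λ j →
           *-cong (reflexive (≡.sym (entry-toℕ w i j))) (basisImage-at-1 r s i j u))) ⟩
    ∑ (suc r) (λ i → ∑ (suc s) (λ j → term (toℕ i) (toℕ j)))
      ≈⟨ ∑∑≈sumℕ-sumℕ (suc r) (suc s) term ⟩
    sumℕ (suc r) (λ a → sumℕ (suc s) (term a))
      ≈⟨ sumℕ-cong (suc r) (λ a _ → sumℕ-extend (term a) s<p (λ b s<b →
           trans (*-congʳ (coef-zero _ a (λ i → reflexive (coef-> (w i) s<b)))) (zeroˡ _))) ⟩
    sumℕ (suc r) (λ a → sumℕ p (term a))
      ≈⟨ sumℕ-extend _ r<p (λ a r<a → sumℕ-zero p (λ b _ →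
           trans (*-congʳ (reflexive (coef-> _ r<a))) (zeroˡ _))) ⟩
    sumℕ p (λ a → sumℕ p (term a))
      ≈⟨ sumℕ-comm p p term ⟩
    sumℕ p (λ b → sumℕ p (λ a → term a b))
      ≈⟨ sumℕ-cong p (λ b _ → sumℕ-cong p (λ a a<p → *-congʳ (reflexive
           (≡.sym (≡.cong₂ (entry w) ([a+b*n]%n≡a a b a<p) ([a+b*n]/n≡b a b a<p)))))) ⟩
    sumℕ p (λ b → sumℕ p (λ a → digitEntry w (a +ℕ b *ℕ p) * u ^ (a +ℕ b *ℕ p)))
      ≈⟨ sym (sumℕ-* p p (λ e → digitEntry w e * u ^ e)) ⟩
    eval (p *ℕ p) (digitEntry w) u
      ∎
    where
    term : ℕ → ℕ → Carrier
    term a b = entry w a b * u ^ (a +ℕ b *ℕ p)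

module PrimeField {ℓ₁ ℓ₂ p} (prime : Prime p) (K : AlgClosureFp p ℓ₁ ℓ₂) where

  open AlgClosureFp K
  open Frobenius commutativeSemiring using ([m*n]×x≈0)
  open import Algebra.Properties.Monoid.Mult +-monoid using (×-homo-+)
  open import Algebra.Properties.Group +-group using (identityʳ-unique)
  open import Relation.Binary.Reasoning.Setoid setoid

  suc-×1≉0 : ∀ {m n} → suc m ≡ n → m ·ℕ 1# ≈ 0# → ¬ (n ·ℕ 1# ≈ 0#)
  suc-×1≉0 {m} ≡.refl m×1≈0 [1+m]×1≈0 = 1≉0 (begin
    1#                 ≈⟨ sym (+-identityʳ 1#) ⟩
    1# + 0#            ≈⟨ +-congˡ (sym m×1≈0) ⟩
    suc m ·ℕ 1#        ≈⟨ [1+m]×1≈0 ⟩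
    0#                 ∎)

  ×1≉0 : ∀ {d} → 0 < d → d < p → ¬ (d ·ℕ 1# ≈ 0#)
  ×1≉0 {d} 0<d d<p d×1≈0 with coprime-Bézout (prime⇒coprime prime {{>-nonZero 0<d}} d<p)
  ... | Bézout.+- x y 1+yd≡xp = suc-×1≉0 1+yd≡xp ([m*n]×x≈0 d×1≈0 y 1#) ([m*n]×x≈0 char-p x 1#)
  ... | Bézout.-+ x y 1+xp≡yd = suc-×1≉0 1+xp≡yd ([m*n]×x≈0 char-p x 1#) ([m*n]×x≈0 d×1≈0 y 1#)

  ×1-gap : ∀ {k k′} → k < k′ → k′ < p → ¬ (k ·ℕ 1# ≈ k′ ·ℕ 1#)
  ×1-gap {k} k<k′ k′<p k≈k′ with ℕₚ.m≤n⇒∃[o]m+o≡n k<k′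
  ... | o , ≡.refl = ×1≉0 (s≤s z≤n) (≤-trans (s≤s (s≤s (ℕₚ.m≤n+m o k))) k′<p)
    (identityʳ-unique (k ·ℕ 1#) _ (sym (begin
      k ·ℕ 1#                      ≈⟨ k≈k′ ⟩
      suc (k +ℕ o) ·ℕ 1#           ≡⟨ cong (_·ℕ 1#) (≡.sym (ℕₚ.+-suc k o)) ⟩
      (k +ℕ suc o) ·ℕ 1#           ≈⟨ ×-homo-+ 1# k (suc o) ⟩
      k ·ℕ 1# + suc o ·ℕ 1#        ∎)))

  ×1-injective : ∀ {k k′} → k < p → k′ < p → k ·ℕ 1# ≈ k′ ·ℕ 1# → k ≡ k′
  ×1-injective {k} {k′} k<p k′<p k≈k′ with ℕₚ.<-cmp k k′
  ... | tri< k<k′ _ _ = ⊥-elim (×1-gap k<k′ k′<p k≈k′)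
  ... | tri≈ _ k≡k′ _ = k≡k′
  ... | tri> _ _ k′<k = ⊥-elim (×1-gap k′<k k<p (sym k≈k′))

module Fp²Points {ℓ₁ ℓ₂ p} (prime : Prime p) (K : AlgClosureFp p ℓ₁ ℓ₂) where

  open AlgClosureFp K
  open Setup K
  open FiniteSums commutativeSemiring
  open Frobenius commutativeSemiring using (frobenius; frobenius-×1#)
  open PolynomialRoots commRing using (*-cancelʳ-nonzero)
  open PrimeField prime K using (×1-injective)
  open import Data.Product using (_×_)
  open import Algebra.Properties.Semiring.Exp semiring using (^-congˡ; ^-assocʳ)
  open import Algebra.Properties.CommutativeSemiring.Exp commutativeSemiring using (^-distrib-*)
  open import Algebra.Properties.Group +-group using (inverseˡ-unique; ⁻¹-involutive; ∙-cancelʳ)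
  open CommutativeSemigroupProperties +-commutativeSemigroup using (x∙yz≈y∙xz)
  open import Algebra.Properties.AbelianGroup +-abelianGroup using (⁻¹-∙-comm)
  open import Algebra.Properties.Ring ring using (-1*x≈-x)
  open import Relation.Binary.Reasoning.Setoid setoid

  p≡2+[p∸2] : p ≡ suc (suc (p ∸ℕ 2))
  p≡2+[p∸2] = ≡.sym (m+[n∸m]≡n (nonTrivial⇒n>1 p {{prime⇒nonTrivial prime}}))

  sum-0* : ∀ n (f : Fin n → Carrier) → sum (λ i → 0# * f i) ≈ 0#
  sum-0* n f = trans (reflexive (sum≡∑ n _)) (trans (∑-cong n (λ _ → zeroˡ _)) (∑-zero n))

  root-X^[1+n]+α : ∀ n α → ∃ λ x → x ^ suc n + α ≈ 0#
  root-X^[1+n]+α n α with algClosed n coefficients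
    where
    coefficients : Fin (suc n) → Carrier
    coefficients Fin.zero    = α
    coefficients (Fin.suc _) = 0#
  ... | x , root = x , trans (+-congˡ (sym (begin
    α * 1# + sum {n} (λ i → 0# * x ^ suc (toℕ i)) ≈⟨ +-cong (*-identityʳ α) (sum-0* n _) ⟩
    α + 0#                                      ≈⟨ +-identityʳ α ⟩
    α                                           ∎))) root

  root-X^[2+n]+βX+α : ∀ n α β → ∃ λ x → x ^ suc (suc n) + (α + β * x) ≈ 0#
  root-X^[2+n]+βX+α n α β with algClosed (suc n) coefficients
    where
    coefficients : Fin (suc (suc n)) → Carrier
    coefficients Fin.zero              = α
    coefficients (Fin.suc Fin.zero)    = β
    coefficients (Fin.suc (Fin.suc _)) = 0#
  ... | x , root = x , trans (+-congˡ (sym (begin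
    α * 1# + (β * (x * 1#) + sum {n} (λ i → 0# * x ^ suc (suc (toℕ i))))
      ≈⟨ +-cong (*-identityʳ α) (trans (+-cong (*-congˡ (*-identityʳ x)) (sum-0* n _)) (+-identityʳ _)) ⟩
    α + β * x
      ∎))) root

  -- Frobenius acts on F_p(θ) by θ ↦ θ + y₀, which has order 2 because y₀^p = -y₀; hence the
  -- points a + bθ lie in F_{p²}.
  y₀ : Carrier
  y₀ = proj₁ (root-X^[1+n]+α (p ∸ℕ 2) 1#)

  y₀^p+y₀≈0 : y₀ ^ p + y₀ ≈ 0#
  y₀^p+y₀≈0 = begin
    y₀ ^ p + y₀                        ≡⟨ cong (λ e → y₀ ^ e + y₀) p≡2+[p∸2] ⟩
    y₀ * y₀ ^ suc (p ∸ℕ 2) + y₀         ≈⟨ +-congˡ (sym (*-identityʳ y₀)) ⟩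
    y₀ * y₀ ^ suc (p ∸ℕ 2) + y₀ * 1#    ≈⟨ sym (distribˡ y₀ _ _) ⟩
    y₀ * (y₀ ^ suc (p ∸ℕ 2) + 1#)       ≈⟨ *-congˡ (proj₂ (root-X^[1+n]+α (p ∸ℕ 2) 1#)) ⟩
    y₀ * 0#                            ≈⟨ zeroʳ y₀ ⟩
    0#                                 ∎

  y₀≉0 : ¬ (y₀ ≈ 0#)
  y₀≉0 y₀≈0 = 1≉0 (begin
    1#                           ≈⟨ sym (+-identityˡ 1#) ⟩
    0# + 1#                      ≈⟨ +-congʳ (sym (trans (*-congʳ y₀≈0) (zeroˡ _))) ⟩
    y₀ ^ suc (p ∸ℕ 2) + 1#       ≈⟨ proj₂ (root-X^[1+n]+α (p ∸ℕ 2) 1#) ⟩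
    0#                           ∎)

  θ : Carrier
  θ = proj₁ (root-X^[2+n]+βX+α (p ∸ℕ 2) (- y₀) (- 1#))

  θ^p≈θ+y₀ : θ ^ p ≈ θ + y₀
  θ^p≈θ+y₀ = begin
    θ ^ p                    ≈⟨ inverseˡ-unique _ _ θ-root ⟩
    - (- y₀ + - 1# * θ)      ≈⟨ -‿cong (+-congˡ (-1*x≈-x θ)) ⟩
    - (- y₀ + - θ)           ≈⟨ sym (⁻¹-∙-comm (- y₀) (- θ)) ⟩
    - - y₀ + - - θ           ≈⟨ +-cong (⁻¹-involutive y₀) (⁻¹-involutive θ) ⟩
    y₀ + θ                   ≈⟨ +-comm y₀ θ ⟩
    θ + y₀                   ∎
    where
    θ-root : θ ^ p + (- y₀ + - 1# * θ) ≈ 0#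
    θ-root = trans (reflexive (cong (λ e → θ ^ e + (- y₀ + - 1# * θ)) p≡2+[p∸2]))
                   (proj₂ (root-X^[2+n]+βX+α (p ∸ℕ 2) (- y₀) (- 1#)))

  point : ℕ → ℕ → Carrier
  point a b = a ·ℕ 1# + (b ·ℕ 1#) * θ

  point^p : ∀ a b → point a b ^ p ≈ a ·ℕ 1# + (b ·ℕ 1#) * (θ + y₀)
  point^p a b = begin
    point a b ^ p                                     ≈⟨ frobenius prime char-p _ _ ⟩
    (a ·ℕ 1#) ^ p + ((b ·ℕ 1#) * θ) ^ p              ≈⟨ +-cong (frobenius-×1# prime char-p a) (^-distrib-* _ θ p) ⟩
    a ·ℕ 1# + (b ·ℕ 1#) ^ p * θ ^ p                  ≈⟨ +-congˡ (*-cong (frobenius-×1# prime char-p b) θ^p≈θ+y₀) ⟩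
    a ·ℕ 1# + (b ·ℕ 1#) * (θ + y₀)                   ∎

  point∈Fp² : ∀ a b → InFp2 (point a b)
  point∈Fp² a b = begin
    point a b ^ (p *ℕ p)                               ≈⟨ sym (^-assocʳ _ p p) ⟩
    (point a b ^ p) ^ p                                ≈⟨ ^-congˡ p (point^p a b) ⟩
    (A + B * (θ + y₀)) ^ p                             ≈⟨ frobenius prime char-p _ _ ⟩
    A ^ p + (B * (θ + y₀)) ^ p                         ≈⟨ +-cong (frobenius-×1# prime char-p a) (^-distrib-* _ _ p) ⟩
    A + B ^ p * (θ + y₀) ^ p                           ≈⟨ +-congˡ (*-cong (frobenius-×1# prime char-p b) (frobenius prime char-p θ y₀)) ⟩
    A + B * (θ ^ p + y₀ ^ p)                           ≈⟨ +-congˡ (*-congˡ (+-congʳ θ^p≈θ+y₀)) ⟩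
    A + B * ((θ + y₀) + y₀ ^ p)                        ≈⟨ +-congˡ (*-congˡ (trans (+-assoc θ y₀ _) (+-congˡ y₀+y₀^p≈0))) ⟩
    A + B * (θ + 0#)                                   ≈⟨ +-congˡ (*-congˡ (+-identityʳ θ)) ⟩
    point a b                                          ∎
    where
    A = a ·ℕ 1#
    B = b ·ℕ 1#
    y₀+y₀^p≈0 : y₀ + y₀ ^ p ≈ 0#
    y₀+y₀^p≈0 = trans (+-comm _ _) y₀^p+y₀≈0

  point-injective : ∀ {a b a′ b′} → a < p → b < p → a′ < p → b′ < p →
                    point a b ≈ point a′ b′ → a ≡ a′ × b ≡ b′
  point-injective {a} {b} {a′} {b′} a<p b<p a′<p b′<p ab≈a′b′ =
    ×1-injective a<p a′<p A≈A′ , ×1-injective b<p b′<p B≈B′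
    where
    A = a ·ℕ 1#
    B = b ·ℕ 1#
    A′ = a′ ·ℕ 1#
    B′ = b′ ·ℕ 1#
    split : ∀ X Y → X + Y * (θ + y₀) ≈ Y * y₀ + (X + Y * θ)
    split X Y = begin
      X + Y * (θ + y₀)          ≈⟨ +-congˡ (distribˡ Y θ y₀) ⟩
      X + (Y * θ + Y * y₀)      ≈⟨ +-congˡ (+-comm _ _) ⟩
      X + (Y * y₀ + Y * θ)      ≈⟨ x∙yz≈y∙xz X (Y * y₀) (Y * θ) ⟩
      Y * y₀ + (X + Y * θ)      ∎
    B≈B′ : B ≈ B′
    B≈B′ = *-cancelʳ-nonzero inverse y₀≉0 (∙-cancelʳ (point a b) _ _ (begin
      B * y₀ + point a b        ≈⟨ sym (split A B) ⟩
      A + B * (θ + y₀)          ≈⟨ sym (point^p a b) ⟩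
      point a b ^ p             ≈⟨ ^-congˡ p ab≈a′b′ ⟩
      point a′ b′ ^ p           ≈⟨ point^p a′ b′ ⟩
      A′ + B′ * (θ + y₀)        ≈⟨ split A′ B′ ⟩
      B′ * y₀ + point a′ b′     ≈⟨ +-congˡ (sym ab≈a′b′) ⟩
      B′ * y₀ + point a b       ∎))
    A≈A′ : A ≈ A′
    A≈A′ = ∙-cancelʳ (B * θ) A A′ (trans ab≈a′b′ (+-congˡ (*-congʳ (sym B≈B′))))

module PsiInjective {ℓ₁ ℓ₂ p} (prime : Prime p) (K : AlgClosureFp p ℓ₁ ℓ₂) where

  open AlgClosureFp K
  open Setup K
  open Frobenius commutativeSemiring using (1^n≈1)
  open PolynomialRoots commRing using (eval; agree⇒coefficients-equal)
  open PsiProperties prime K using (entry; entry-toℕ; digitEntry; Ψ-at-1)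
  open Fp²Points prime K using (point; point∈Fp²; point-injective)
  open import Relation.Binary.Reasoning.Setoid setoid

  private instance
    p≢0 : NonZero p
    p≢0 = prime⇒nonZero prime

  digitPoint : ℕ → Carrier
  digitPoint e = point (e % p) (e / p)

  digitPoint-injective : ∀ {e e′} → e < p *ℕ p → e′ < p *ℕ p → digitPoint e ≈ digitPoint e′ → e ≡ e′
  digitPoint-injective {e} {e′} e<p² e′<p² eq =
    ≡.trans (m≡m%n+[m/n]*n e p)
      (≡.trans (≡.cong₂ (λ a b → a +ℕ b *ℕ p) (proj₁ digits≡) (proj₂ digits≡)) (≡.sym (m≡m%n+[m/n]*n e′ p)))
    where
    digits≡ = point-injective (m%n<n e p) (m<n*o⇒m/o<n e<p²) (m%n<n e′ p) (m<n*o⇒m/o<n e′<p²) eq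

  Ψ-injective : ∀ {r s} → r < p → s < p → (w w′ : V r s) → Ψ r s w ≈U Ψ r s w′ → w ≈V w′
  Ψ-injective {r} {s} r<p s<p w w′ Ψw≈Ψw′ i j = begin
    w i j                          ≡⟨ ≡.sym (≡.trans (digits w) (entry-toℕ w i j)) ⟩
    digitEntry w e                 ≈⟨ agree⇒coefficients-equal inverse (p *ℕ p) (digitEntry w) (digitEntry w′)
                                        digitPoint digitPoint-injective agree e e<p² ⟩
    digitEntry w′ e                ≡⟨ ≡.trans (digits w′) (entry-toℕ w′ i j) ⟩
    w′ i j                         ∎
    where
    e = toℕ i +ℕ toℕ j *ℕ p
    i<p = ≤-trans (toℕ<n i) r<p
    j<p = ≤-trans (toℕ<n j) s<p
    e<p² : e < p *ℕ p
    e<p² = ℕₚ.<-≤-trans (ℕₚ.+-monoˡ-< (toℕ j *ℕ p) i<p) (ℕₚ.*-monoˡ-≤ p j<p)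
    digits : ∀ (w : V r s) → digitEntry w e ≡ entry w (toℕ i) (toℕ j)
    digits w = ≡.cong₂ (entry w) ([a+b*n]%n≡a (toℕ i) (toℕ j) i<p) ([a+b*n]/n≡b (toℕ i) (toℕ j) i<p)
    agree : ∀ e → e < p *ℕ p →
            eval (p *ℕ p) (digitEntry w) (digitPoint e) ≈ eval (p *ℕ p) (digitEntry w′) (digitPoint e)
    agree e _ = begin
      eval (p *ℕ p) (digitEntry w) (digitPoint e)   ≈⟨ sym (Ψ-at-1 r<p s<p w _) ⟩
      Ψ r s w (digitPoint e) 1#                     ≈⟨ Ψw≈Ψw′ _ 1# (point∈Fp² (e % p) (e / p)) (1^n≈1 (p *ℕ p)) ⟩
      Ψ r s w′ (digitPoint e) 1#                    ≈⟨ Ψ-at-1 r<p s<p w′ _ ⟩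
      eval (p *ℕ p) (digitEntry w′) (digitPoint e)  ∎

lemma4p1 : ∀ {c ℓ : Level} (p : ℕ) → Prime p → (K : AlgClosureFp p c ℓ) →
    (r s q t : ℕ) → r < p → s < p →
    Setup.IsModuleEmbedding K r s q t
lemma4p1 p p-prime K r s q t r<p s<p = record
  { lands-in-U  = λ w x u v _ _ _ _ → Ψ-homogeneous r s w x u v
  ; additive    = λ w w′ u v _ _ → Ψ-+ r s w w′ u v
  ; homogen     = λ λ′ w u v _ _ → Ψ-* r s λ′ w u v
  ; equivariant = λ M w u v _ _ → Ψ-equivariant r s q t M w u v
  ; injective   = Ψ-injective r<p s<p
  }
  where
  open PsiProperties p-prime K using (Ψ-homogeneous; Ψ-+; Ψ-*; Ψ-equivariant)
  open PsiInjective p-prime K using (Ψ-injective)
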